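{- For each $i\in\{1,2,3\}$, the closed subgroup of $W=\mathrm{Aut}(T)$ generated by $a_i$ is isomorphic to $\mathbb{Z}_2$, the $2$-adic integers.
   Context: $T$ is the infinite rooted binary tree of finite words over $\{1,2\}$ with its profinite automorphism group $W$. For automorphisms $u,v$, $(u,v)$ acts by $1w\mapsto1u(w)$, $2w\mapsto2v(w)$; $\sigma$ swaps the first letter; $(u,v)\sigma=(u,v)\circ\sigma$. $a_1,a_2,a_3\in W$ are defined recursively by $a_1=(\mathrm{id},a_3)$, $a_2=(\mathrm{id},a_1)\sigma$, $a_3=(a_2,\mathrm{id})\sigma$. -}

module Defs where

open import Data.Bool using (Bool; true; false; not; _xor_; _∧_; _∨_)
open import Data.Nat using (ℕ; zero; suc; _<_)
open import Data.Integer using (ℤ; +_; -[1+_])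
open import Data.List using (List; []; _∷_; length)
open import Data.Fin using (Fin)
open import Data.Product using (Σ; ∃; _×_; _,_)
open import Relation.Binary.PropositionalEquality using (_≡_)

-- The binary tree T: finite words over {1,2}; letter 1 = false, 2 = true.

Word : Set
Word = List Bool

-- W = Aut(T), represented by portraits: an automorphism g is determined by
-- the labels g(v) ∈ Bool (true = the section g|_v swaps the first letter).

Aut : Set
Aut = Word → Bool

act : Aut → Word → Word
act g []      = []
act g (x ∷ w) = (g [] xor x) ∷ act (λ v → g (x ∷ v)) w

actInv : Aut → Word → Word
actInv g []      = []
actInv g (y ∷ w) = (g [] xor y) ∷ actInv (λ v → g ((g [] xor y) ∷ v)) w

-- identity, composition (g ∘ h = first h, then g), inverse
idA : Aut
idA _ = false

_∘A_ : Aut → Aut → Aut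
(g ∘A h) v = h v xor g (act h v)

invA : Aut → Aut
invA g v = g (actInv g v)

_≈A_ : Aut → Aut → Set
g ≈A h = ∀ v → g v ≡ h v

powℕ : Aut → ℕ → Aut
powℕ g zero    = idA
powℕ g (suc n) = g ∘A powℕ g n

pow : Aut → ℤ → Aut
pow g (+ n)    = powℕ g n
pow g -[1+ n ] = powℕ (invA g) (suc n)

-- Profinite topology on W: g and h are close at depth n if their portraits
-- agree on all vertices of length < n (equivalently they act identically
-- on the first n levels).
AgreeA : ℕ → Aut → Aut → Set
AgreeA n g h = ∀ v → length v < n → g v ≡ h v

InClosure : Aut → Aut → Set
InClosure a g = ∀ n → ∃ λ (k : ℤ) → AgreeA n g (pow a k)

-- The generators a₁, a₂, a₃ (indexed by Fin 3: 0 ↦ a₁, 1 ↦ a₂, 2 ↦ a₃)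
--   a₁ = (id, a₃),  a₂ = (id, a₁) σ,  a₃ = (a₂, id) σ,
-- where (u,v)σ = (u,v) ∘ σ: first σ, then (u,v).  Hence
-- a₂(1w) = 2 a₁(w), a₂(2w) = 1 w, a₃(1w) = 2 w, a₃(2w) = 1 a₂(w).

a₁ a₂ a₃ : Aut
a₁ []          = false
a₁ (false ∷ w) = false
a₁ (true ∷ w)  = a₃ w
a₂ []          = true
a₂ (false ∷ w) = a₁ w
a₂ (true ∷ w)  = false
a₃ []          = true
a₃ (false ∷ w) = false
a₃ (true ∷ w)  = a₂ w

gen : Fin 3 → Aut
gen Fin.zero             = a₁
gen (Fin.suc Fin.zero)   = a₂
gen (Fin.suc (Fin.suc Fin.zero)) = a₃

-- The 2-adic integers ℤ₂, as digit streams x = Σ x(n) 2^n.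

ℤ₂ : Set
ℤ₂ = ℕ → Bool

maj : Bool → Bool → Bool → Bool
maj a b c = (a ∧ b) ∨ (a ∧ c) ∨ (b ∧ c)

carry : ℤ₂ → ℤ₂ → ℕ → Bool
carry x y zero    = false
carry x y (suc n) = maj (x n) (y n) (carry x y n)

_+₂_ : ℤ₂ → ℤ₂ → ℤ₂
(x +₂ y) n = (x n xor y n) xor carry x y n

_≈₂_ : ℤ₂ → ℤ₂ → Set
x ≈₂ y = ∀ n → x n ≡ y n

Agree₂ : ℕ → ℤ₂ → ℤ₂ → Set
Agree₂ m x y = ∀ i → i < m → x i ≡ y i

record IsTopIsoOntoClosure (a : Aut) (φ : ℤ₂ → Aut) : Set where
  field
    into       : ∀ x → InClosure a (φ x)
    onto       : ∀ g → InClosure a g → ∃ λ x → φ x ≈A g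
    injective  : ∀ x y → φ x ≈A φ y → x ≈₂ y
    homomorph  : ∀ x y → φ (x +₂ y) ≈A (φ x ∘A φ y)
    continuous : ∀ n → ∃ λ m → ∀ x y → Agree₂ m x y → AgreeA n (φ x) (φ y)
    continuous⁻¹ : ∀ m → ∃ λ n → ∀ x y → AgreeA n (φ x) (φ y) → Agree₂ m x y

ClosedSubgroupIsoℤ₂ : Aut → Set
ClosedSubgroupIsoℤ₂ a = ∃ λ (φ : ℤ₂ → Aut) → IsTopIsoOntoClosure a φ

-- An automorphism fixes level n of T iff its portrait vanishes on the vertices of depth < n.
-- For a = aᵢ, aᵈ fixes level n as soon as 2ⁿ ∣ d: a₁ᵈ has sections (id , a₃ᵈ), and a₂² (resp. a₃²)
-- has both sections equal to a₁ (resp. a₂), so this follows by induction on n. Conversely an odd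
-- power of a₂ or a₃ swaps at the root, so fixing a level forces an even exponent; one turn of the
-- cycle a₁ → a₃ → a₂ → a₁ of sections descends three levels and halves the exponent twice, hence
-- aᵈ fixing level 3m forces 2ᵐ ∣ d. So the action of aʲ on the levels of T determines and is
-- determined by the residues of j modulo powers of 2, and x ↦ lim a^(x mod 2ⁿ) is an isomorphism
-- of topological groups from ℤ₂ onto the closure of ⟨a⟩.

module Submission where

open import Algebra.Bundles using (Monoid)
import Algebra.Properties.Monoid.Mult as MonoidMult
open import Data.Bool using (Bool; true; false; not; _xor_)
open import Data.Bool.Properties using (xor-assoc; xor-comm; xor-same; xor-identityʳ; true-xor)
open import Data.Empty using (⊥-elim)
open import Data.Fin using (Fin)
import Data.Integer as ℤ
open import Data.List using ([]; _∷_; length)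
open import Data.Nat using (ℕ; zero; suc; _+_; _*_; _^_; _≤_; _<_; z≤n; s≤s; NonZero; ⌊_/2⌋)
open import Data.Nat.Divisibility using (_∣_; divides; 1∣_; n∣m*n; ∣-trans)
open import Data.Nat.DivMod using (_%_; _/_; [m+kn]%n≡m%n; m<n⇒m%n≡m; m≡m%n+[m/n]*n)
open import Data.Nat.Properties
open import Data.Nat.Tactic.RingSolver using (solve-∀)
open import Data.Product using (∃; _×_; _,_; proj₁; proj₂)
open import Data.Sum using (inj₁; inj₂)
open import Level using (0ℓ)
open import Relation.Binary.Bundles using (Setoid)
open import Relation.Binary.Structures using (IsEquivalence)
open import Relation.Binary.PropositionalEquality using (_≡_; refl; sym; trans; cong; cong₂; subst; module ≡-Reasoning)
import Relation.Binary.Reasoning.Setoid as SetoidReasoning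
open import Relation.Nullary using (¬_)

open import Defs

xor-cancelˡ : ∀ a x → a xor (a xor x) ≡ x
xor-cancelˡ a x = trans (sym (xor-assoc a a x)) (cong (_xor x) (xor-same a))

xor-injective : ∀ a {x y} → a xor x ≡ a xor y → x ≡ y
xor-injective a {x} {y} e = trans (sym (xor-cancelˡ a x)) (trans (cong (a xor_) e) (xor-cancelˡ a y))

length-act : ∀ g w → length (act g w) ≡ length w
length-act g []      = refl
length-act g (x ∷ w) = cong suc (length-act _ w)

length-actInv : ∀ g w → length (actInv g w) ≡ length w
length-actInv g []      = refl
length-actInv g (y ∷ w) = cong suc (length-actInv _ w)

act-actInv : ∀ g w → act g (actInv g w) ≡ w
act-actInv g []      = refl
act-actInv g (y ∷ w) = cong₂ _∷_ (xor-cancelˡ (g []) y) (act-actInv _ w)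

actInv-act : ∀ g w → actInv g (act g w) ≡ w
actInv-act g []      = refl
actInv-act g (x ∷ w) rewrite xor-cancelˡ (g []) x = cong (x ∷_) (actInv-act _ w)

act-idA : ∀ w → act idA w ≡ w
act-idA []      = refl
act-idA (x ∷ w) = cong (x ∷_) (act-idA w)

act-∘ : ∀ g h w → act (g ∘A h) w ≡ act g (act h w)
act-∘ g h []      = refl
act-∘ g h (x ∷ w) =
  cong₂ _∷_ (trans (cong (_xor x) (xor-comm (h []) (g []))) (xor-assoc (g []) (h []) x))
            (act-∘ _ _ w)

act-cong : ∀ {g h} → g ≈A h → ∀ w → act g w ≡ act h w
act-cong e []      = refl
act-cong e (x ∷ w) = cong₂ _∷_ (cong (_xor x) (e [])) (act-cong (λ v → e (x ∷ v)) w)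

≈A-isEquivalence : IsEquivalence _≈A_
≈A-isEquivalence = record
  { refl  = λ _ → refl
  ; sym   = λ e v → sym (e v)
  ; trans = λ e f v → trans (e v) (f v)
  }

∘-cong : ∀ {g g′ h h′} → g ≈A g′ → h ≈A h′ → (g ∘A h) ≈A (g′ ∘A h′)
∘-cong {g} {h′ = h′} eg eh v =
  cong₂ _xor_ (eh v) (trans (cong g (act-cong eh v)) (eg (act h′ v)))

∘-congˡ : ∀ g {h h′} → h ≈A h′ → (g ∘A h) ≈A (g ∘A h′)
∘-congˡ g {h} {h′} = ∘-cong {g} {g} {h} {h′} (λ _ → refl)

∘-congʳ : ∀ h {g g′} → g ≈A g′ → (g ∘A h) ≈A (g′ ∘A h)
∘-congʳ h {g} {g′} eg = ∘-cong {g} {g′} {h} {h} eg (λ _ → refl)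

∘-assoc : ∀ g h k → ((g ∘A h) ∘A k) ≈A (g ∘A (h ∘A k))
∘-assoc g h k v =
  trans (sym (xor-assoc (k v) (h (act k v)) (g (act h (act k v)))))
        (cong (λ w → (k v xor h (act k v)) xor g w) (sym (act-∘ h k v)))

∘-identityˡ : ∀ g → (idA ∘A g) ≈A g
∘-identityˡ g v = xor-identityʳ (g v)

∘-identityʳ : ∀ g → (g ∘A idA) ≈A g
∘-identityʳ g v = cong g (act-idA v)

invA-inverseˡ : ∀ g → (invA g ∘A g) ≈A idA
invA-inverseˡ g v = trans (cong (λ w → g v xor g w) (actInv-act g v)) (xor-same (g v))

portraitMonoid : Monoid 0ℓ 0ℓ
portraitMonoid = record
  { Carrier  = Aut
  ; _≈_      = _≈A_
  ; _∙_      = _∘A_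
  ; ε        = idA
  ; isMonoid = record
    { isSemigroup = record
      { isMagma = record { isEquivalence = ≈A-isEquivalence ; ∙-cong = ∘-cong }
      ; assoc   = ∘-assoc
      }
    ; identity = ∘-identityˡ , ∘-identityʳ
    }
  }

open MonoidMult portraitMonoid using (×-homo-+; ×-assocˡ) renaming (_×_ to _×ᴹ_)
open Monoid portraitMonoid using () renaming (setoid to ≈A-setoid; refl to ≈A-refl; sym to ≈A-sym)

powℕ≡×ᴹ : ∀ g d → powℕ g d ≡ d ×ᴹ g
powℕ≡×ᴹ g zero    = refl
powℕ≡×ᴹ g (suc d) = cong (g ∘A_) (powℕ≡×ᴹ g d)

pow-+ : ∀ g m n → powℕ g (m + n) ≈A (powℕ g m ∘A powℕ g n)
pow-+ g m n rewrite powℕ≡×ᴹ g (m + n) | powℕ≡×ᴹ g m | powℕ≡×ᴹ g n = ×-homo-+ g m n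

pow-* : ∀ g m n → powℕ g (m * n) ≈A powℕ (powℕ g n) m
pow-* g m n rewrite powℕ≡×ᴹ g (m * n) | powℕ≡×ᴹ g n | powℕ≡×ᴹ (n ×ᴹ g) m =
  ≈A-sym (×-assocˡ g m n)

pow-idA : ∀ d → powℕ idA d ≈A idA
pow-idA zero    _ = refl
pow-idA (suc d) v = trans (∘-identityˡ (powℕ idA d) v) (pow-idA d v)

pow-invA-inverseˡ : ∀ g s → (powℕ (invA g) s ∘A powℕ g s) ≈A idA
pow-invA-inverseˡ g zero    = ∘-identityˡ idA
pow-invA-inverseˡ g (suc s) = begin
  (invA g ∘A B) ∘A powℕ g (suc s) ≈⟨ ∘-congˡ (invA g ∘A B) powℕ-suc-right ⟩
  (invA g ∘A B) ∘A (A ∘A g)       ≈⟨ ∘-assoc (invA g) B (A ∘A g) ⟩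
  invA g ∘A (B ∘A (A ∘A g))       ≈⟨ ∘-congˡ (invA g) (≈A-sym (∘-assoc B A g)) ⟩
  invA g ∘A ((B ∘A A) ∘A g)       ≈⟨ ∘-congˡ (invA g) (∘-congʳ g (pow-invA-inverseˡ g s)) ⟩
  invA g ∘A (idA ∘A g)            ≈⟨ ∘-congˡ (invA g) (∘-identityˡ g) ⟩
  invA g ∘A g                     ≈⟨ invA-inverseˡ g ⟩
  idA                             ∎
  where
  open SetoidReasoning ≈A-setoid
  A = powℕ g s
  B = powℕ (invA g) s
  powℕ-suc-right : powℕ g (suc s) ≈A (A ∘A g)
  powℕ-suc-right = begin
    powℕ g (suc s)  ≡⟨ cong (powℕ g) (+-comm 1 s) ⟩
    powℕ g (s + 1)  ≈⟨ pow-+ g s 1 ⟩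
    A ∘A (g ∘A idA) ≈⟨ ∘-congˡ A (∘-identityʳ g) ⟩
    A ∘A g          ∎

agree-isEquivalence : ∀ n → IsEquivalence (AgreeA n)
agree-isEquivalence n = record
  { refl  = λ _ _ → refl
  ; sym   = λ e v lt → sym (e v lt)
  ; trans = λ e f v lt → trans (e v lt) (f v lt)
  }

agree-setoid : ℕ → Setoid 0ℓ 0ℓ
agree-setoid n = record { isEquivalence = agree-isEquivalence n }

module AgreeReasoning (n : ℕ) = SetoidReasoning (agree-setoid n)

≈⇒agree : ∀ n {g h} → g ≈A h → AgreeA n g h
≈⇒agree n e v _ = e v

agree-mono : ∀ {m n g h} → m ≤ n → AgreeA n g h → AgreeA m g h
agree-mono m≤n ag v lt = ag v (<-≤-trans lt m≤n)

act-agree : ∀ {n} g h w → AgreeA n g h → length w ≤ n → act g w ≡ act h w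
act-agree         g h []      ag _         = refl
act-agree {suc n} g h (x ∷ w) ag (s≤s len) = cong₂ _∷_
  (cong (_xor x) (ag [] (s≤s z≤n)))
  (act-agree (λ v → g (x ∷ v)) (λ v → h (x ∷ v)) w (λ v lt → ag (x ∷ v) (s≤s lt)) len)

∘-cong-agree : ∀ n {g g′ h h′} → AgreeA n g g′ → AgreeA n h h′ → AgreeA n (g ∘A h) (g′ ∘A h′)
∘-cong-agree n {g} {h = h} {h′} ag ah v lt = cong₂ _xor_ (ah v lt)
  (trans (cong g (act-agree h h′ v ah (<⇒≤ lt)))
         (ag (act h′ v) (subst (_< n) (sym (length-act h′ v)) lt)))

∘-cancelʳ-agree : ∀ n {g g′} h → AgreeA n (g ∘A h) (g′ ∘A h) → AgreeA n g g′
∘-cancelʳ-agree n {g} {g′} h ag u lt =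
  subst (λ w → g w ≡ g′ w) (act-actInv h u)
    (xor-injective (h (actInv h u)) (ag (actInv h u) (subst (_< n) (sym (length-actInv h u)) lt)))

agree-sym : ∀ {n g h} → AgreeA n g h → AgreeA n h g
agree-sym {n} = IsEquivalence.sym (agree-isEquivalence n)

agree-trans : ∀ {n g h k} → AgreeA n g h → AgreeA n h k → AgreeA n g k
agree-trans {n} = IsEquivalence.trans (agree-isEquivalence n)

FixesLevel : ℕ → Aut → Set
FixesLevel n g = AgreeA n g idA

pow-periodic : ∀ n g k e → FixesLevel n (powℕ g e) → AgreeA n (powℕ g (k + e)) (powℕ g k)
pow-periodic n g k e fix = begin
  powℕ g (k + e)          ≈⟨ ≈⇒agree n (pow-+ g k e) ⟩
  powℕ g k ∘A powℕ g e    ≈⟨ ∘-cong-agree n {powℕ g k} {powℕ g k} (λ _ _ → refl) fix ⟩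
  powℕ g k ∘A idA         ≈⟨ ≈⇒agree n (∘-identityʳ (powℕ g k)) ⟩
  powℕ g k                ∎
  where open AgreeReasoning n

pow-agree⇒fixesLevel : ∀ n g j d → AgreeA n (powℕ g j) (powℕ g (j + d)) → FixesLevel n (powℕ g d)
pow-agree⇒fixesLevel n g j d ag = ∘-cancelʳ-agree n (powℕ g j) (begin
  powℕ g d ∘A powℕ g j   ≈⟨ ≈⇒agree n (≈A-sym (pow-+ g d j)) ⟩
  powℕ g (d + j)         ≡⟨ cong (powℕ g) (+-comm d j) ⟩
  powℕ g (j + d)         ≈⟨ agree-sym ag ⟩
  powℕ g j               ≈⟨ ≈⇒agree n (≈A-sym (∘-identityˡ (powℕ g j))) ⟩
  idA ∘A powℕ g j        ∎)
  where open AgreeReasoning n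

invA-pow-agree : ∀ n g s o → FixesLevel n (powℕ g (o + s)) → AgreeA n (powℕ (invA g) s) (powℕ g o)
invA-pow-agree n g s o fix = ∘-cancelʳ-agree n (powℕ g s) (begin
  powℕ (invA g) s ∘A powℕ g s  ≈⟨ ≈⇒agree n (pow-invA-inverseˡ g s) ⟩
  idA                          ≈⟨ agree-sym fix ⟩
  powℕ g (o + s)               ≈⟨ ≈⇒agree n (pow-+ g o s) ⟩
  powℕ g o ∘A powℕ g s         ∎)
  where open AgreeReasoning n

section : Aut → Bool → Aut
section g b w = g (b ∷ w)

-- Sections are indexed by the source letter: the paper's (u , v)σ has section v at 1 and u at 2.
record HasSections (g : Aut) (r : Bool) (u v : Aut) : Set where
  field
    root     : g [] ≡ r
    section₁ : section g false ≈A u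
    section₂ : section g true ≈A v

HasSections-resp : ∀ {g g′ r u u′ v v′} → g ≈A g′ → u ≈A u′ → v ≈A v′ →
                   HasSections g r u v → HasSections g′ r u′ v′
HasSections-resp eg eu ev G = record
  { root     = trans (sym (eg [])) G.root
  ; section₁ = λ w → trans (sym (eg (false ∷ w))) (trans (G.section₁ w) (eu w))
  ; section₂ = λ w → trans (sym (eg (true ∷ w))) (trans (G.section₂ w) (ev w))
  }
  where module G = HasSections G

HasSections-∘ : ∀ {g h r s u v p q} → HasSections g r u v → HasSections h s p q →
                HasSections (g ∘A h) (s xor r) (section g s ∘A p) (section g (not s) ∘A q)
-- section (g ∘A h) b reduces to section g (h [] xor b) ∘A section h b.
HasSections-∘ {g} {h} {s = s} G H = record
  { root     = cong₂ _xor_ H.root G.root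
  ; section₁ = ∘-cong {section g (h [] xor false)} {section g s}
                      (λ w → cong (λ b → g (b ∷ w)) (trans (cong (_xor false) H.root) (xor-identityʳ s)))
                      H.section₁
  ; section₂ = ∘-cong {section g (h [] xor true)} {section g (not s)}
                      (λ w → cong (λ b → g (b ∷ w)) (trans (cong (_xor true) H.root) (trans (xor-comm s true) (true-xor s))))
                      H.section₂
  }
  where
  module G = HasSections G
  module H = HasSections H

HasSections-pow : ∀ {g u v} → HasSections g false u v →
                  ∀ d → HasSections (powℕ g d) false (powℕ u d) (powℕ v d)
HasSections-pow G zero    = record { root = refl ; section₁ = λ _ → refl ; section₂ = λ _ → refl }
HasSections-pow {u = u} {v} G (suc d) =
  HasSections-resp ≈A-refl (∘-congʳ (powℕ u d) G.section₁) (∘-congʳ (powℕ v d) G.section₂)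
    (HasSections-∘ G (HasSections-pow G d))
  where module G = HasSections G

HasSections-square : ∀ {g u v} → HasSections g true u v → HasSections (powℕ g 2) false (v ∘A u) (u ∘A v)
HasSections-square {g} {u} {v} G =
  HasSections-resp (∘-congˡ g (≈A-sym (∘-identityʳ g))) (∘-congʳ u G.section₂) (∘-congʳ v G.section₁)
    (HasSections-∘ G G)
  where module G = HasSections G

fixesLevel-suc : ∀ {n g u v} → HasSections g false u v → FixesLevel n u → FixesLevel n v →
                 FixesLevel (suc n) g
fixesLevel-suc G fu fv []          _       = HasSections.root G
fixesLevel-suc G fu fv (false ∷ w) (s≤s lt) = trans (HasSections.section₁ G w) (fu w lt)
fixesLevel-suc G fu fv (true ∷ w)  (s≤s lt) = trans (HasSections.section₂ G w) (fv w lt)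

fixesLevel-sections : ∀ {n g u v} → HasSections g false u v → FixesLevel (suc n) g →
                      FixesLevel n u × FixesLevel n v
fixesLevel-sections G fg =
  (λ w lt → trans (sym (HasSections.section₁ G w)) (fg (false ∷ w) (s≤s lt))) ,
  (λ w lt → trans (sym (HasSections.section₂ G w)) (fg (true ∷ w) (s≤s lt)))

root-swap⇒¬fixesLevel : ∀ {n g} → g [] ≡ true → ¬ FixesLevel (suc n) g
root-swap⇒¬fixesLevel swap fg with trans (sym swap) (fg [] (s≤s z≤n))
... | ()

HasSections-even-pow : ∀ {g u v} → HasSections (powℕ g 2) false u v →
                       ∀ e → HasSections (powℕ g (e * 2)) false (powℕ u e) (powℕ v e)
HasSections-even-pow {g} G² e =
  HasSections-resp (≈A-sym (pow-* g e 2)) ≈A-refl ≈A-refl (HasSections-pow G² e)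

bitℕ : Bool → ℕ
bitℕ false = 0
bitℕ true  = 1

lowBit : ℕ → Bool
lowBit zero          = false
lowBit (suc zero)    = true
lowBit (suc (suc n)) = lowBit n

n≡lowBit+⌊n/2⌋*2 : ∀ n → n ≡ bitℕ (lowBit n) + ⌊ n /2⌋ * 2
n≡lowBit+⌊n/2⌋*2 zero          = refl
n≡lowBit+⌊n/2⌋*2 (suc zero)    = refl
n≡lowBit+⌊n/2⌋*2 (suc (suc n)) =
  trans (cong (2 +_) (n≡lowBit+⌊n/2⌋*2 n)) (shift (bitℕ (lowBit n)) ⌊ n /2⌋)
  where
  shift : ∀ b h → 2 + (b + h * 2) ≡ b + suc h * 2
  shift = solve-∀

even-pow-descent : ∀ {g u k} → g [] ≡ true → HasSections (powℕ g 2) false u u →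
                   ∀ d → FixesLevel (suc k) (powℕ g d) → ∃ λ e → d ≡ e * 2 × FixesLevel k (powℕ u e)
even-pow-descent {g} {k = k} swap G² d fix with lowBit d | n≡lowBit+⌊n/2⌋*2 d
... | false | d≡e*2 = ⌊ d /2⌋ , d≡e*2 ,
  proj₁ (fixesLevel-sections (HasSections-even-pow G² ⌊ d /2⌋)
                             (subst (λ n → FixesLevel (suc k) (powℕ g n)) d≡e*2 fix))
... | true | d≡1+e*2 = ⊥-elim (root-swap⇒¬fixesLevel
  (cong₂ _xor_ (HasSections.root (HasSections-even-pow G² ⌊ d /2⌋)) swap)
  (subst (λ n → FixesLevel (suc k) (powℕ g n)) d≡1+e*2 fix))

record DyadicStabilisers (a : Aut) : Set where
  field
    divisible⇒fixesLevel : ∀ n {d} → 2 ^ n ∣ d → FixesLevel n (powℕ a d)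
    fixesLevel⇒divisible : ∀ m {d} → FixesLevel (m * 3) (powℕ a d) → 2 ^ m ∣ d

a₁-sections : HasSections a₁ false idA a₃
a₁-sections = record { root = refl ; section₁ = λ _ → refl ; section₂ = λ _ → refl }

a₂-sections : HasSections a₂ true a₁ idA
a₂-sections = record { root = refl ; section₁ = λ _ → refl ; section₂ = λ _ → refl }

a₃-sections : HasSections a₃ true idA a₂
a₃-sections = record { root = refl ; section₁ = λ _ → refl ; section₂ = λ _ → refl }

a₁-pow-sections : ∀ d → HasSections (powℕ a₁ d) false idA (powℕ a₃ d)
a₁-pow-sections d = HasSections-resp ≈A-refl (pow-idA d) ≈A-refl (HasSections-pow a₁-sections d)

a₂-square-sections : HasSections (powℕ a₂ 2) false a₁ a₁
a₂-square-sections =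
  HasSections-resp ≈A-refl (∘-identityˡ a₁) (∘-identityʳ a₁) (HasSections-square a₂-sections)

a₃-square-sections : HasSections (powℕ a₃ 2) false a₂ a₂
a₃-square-sections =
  HasSections-resp ≈A-refl (∘-identityʳ a₂) (∘-identityˡ a₂) (HasSections-square a₃-sections)

2^1+n∣d⇒d≡e*2 : ∀ n {d} → 2 ^ suc n ∣ d → ∃ λ e → d ≡ e * 2 × 2 ^ n ∣ e
2^1+n∣d⇒d≡e*2 n (divides q refl) = q * 2 ^ n , regroup q (2 ^ n) , divides q refl
  where
  regroup : ∀ q p → q * (2 * p) ≡ q * p * 2
  regroup = solve-∀

a₁-divisible⇒fixesLevel : ∀ n {d} → 2 ^ n ∣ d → FixesLevel n (powℕ a₁ d)
a₂-divisible⇒fixesLevel : ∀ n {d} → 2 ^ n ∣ d → FixesLevel n (powℕ a₂ d)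
a₃-divisible⇒fixesLevel : ∀ n {d} → 2 ^ n ∣ d → FixesLevel n (powℕ a₃ d)

a₁-divisible⇒fixesLevel zero    _ _ ()
a₁-divisible⇒fixesLevel (suc n) {d} 2^1+n∣d = fixesLevel-suc (a₁-pow-sections d) (λ _ _ → refl)
  (a₃-divisible⇒fixesLevel n (∣-trans (n∣m*n 2) 2^1+n∣d))

a₂-divisible⇒fixesLevel zero    _ _ ()
a₂-divisible⇒fixesLevel (suc n) 2^1+n∣d with 2^1+n∣d⇒d≡e*2 n 2^1+n∣d
... | e , refl , 2^n∣e = fixesLevel-suc (HasSections-even-pow a₂-square-sections e)
  (a₁-divisible⇒fixesLevel n 2^n∣e) (a₁-divisible⇒fixesLevel n 2^n∣e)

a₃-divisible⇒fixesLevel zero    _ _ ()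
a₃-divisible⇒fixesLevel (suc n) 2^1+n∣d with 2^1+n∣d⇒d≡e*2 n 2^1+n∣d
... | e , refl , 2^n∣e = fixesLevel-suc (HasSections-even-pow a₃-square-sections e)
  (a₂-divisible⇒fixesLevel n 2^n∣e) (a₂-divisible⇒fixesLevel n 2^n∣e)

a₁-descent : ∀ {k} d → FixesLevel (suc k) (powℕ a₁ d) → FixesLevel k (powℕ a₃ d)
a₁-descent d fix = proj₂ (fixesLevel-sections (a₁-pow-sections d) fix)

a₂-descent : ∀ {k} d → FixesLevel (suc k) (powℕ a₂ d) → ∃ λ e → d ≡ e * 2 × FixesLevel k (powℕ a₁ e)
a₂-descent = even-pow-descent refl a₂-square-sections

a₃-descent : ∀ {k} d → FixesLevel (suc k) (powℕ a₃ d) → ∃ λ e → d ≡ e * 2 × FixesLevel k (powℕ a₂ e)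
a₃-descent = even-pow-descent refl a₃-square-sections

2^m∣f⇒2^1+m∣f*2*2 : ∀ m {f} → 2 ^ m ∣ f → 2 ^ suc m ∣ f * 2 * 2
2^m∣f⇒2^1+m∣f*2*2 m (divides q refl) = divides (q * 2) (regroup q (2 ^ m))
  where
  regroup : ∀ q p → q * p * 2 * 2 ≡ q * 2 * (2 * p)
  regroup = solve-∀

a₁-fixesLevel⇒divisible : ∀ m {d} → FixesLevel (m * 3) (powℕ a₁ d) → 2 ^ m ∣ d
a₁-fixesLevel⇒divisible zero    {d} _ = 1∣ d
a₁-fixesLevel⇒divisible (suc m) {d} fix with a₃-descent d (a₁-descent d fix)
... | e , refl , fix′ with a₂-descent e fix′
... | f , refl , fix″ = 2^m∣f⇒2^1+m∣f*2*2 m (a₁-fixesLevel⇒divisible m {f} fix″)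

a₂-fixesLevel⇒divisible : ∀ m {d} → FixesLevel (m * 3) (powℕ a₂ d) → 2 ^ m ∣ d
a₂-fixesLevel⇒divisible zero    {d} _ = 1∣ d
a₂-fixesLevel⇒divisible (suc m) {d} fix with a₂-descent d fix
... | e , refl , fix′ with a₃-descent e (a₁-descent e fix′)
... | f , refl , fix″ = 2^m∣f⇒2^1+m∣f*2*2 m (a₂-fixesLevel⇒divisible m {f} fix″)

a₃-fixesLevel⇒divisible : ∀ m {d} → FixesLevel (m * 3) (powℕ a₃ d) → 2 ^ m ∣ d
a₃-fixesLevel⇒divisible zero    {d} _ = 1∣ d
a₃-fixesLevel⇒divisible (suc m) {d} fix with a₃-descent d fix
... | e , refl , fix′ with a₂-descent e fix′
... | f , refl , fix″ = 2^m∣f⇒2^1+m∣f*2*2 m (a₃-fixesLevel⇒divisible m {f} (a₁-descent f fix″))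

dyadicStabilisers : ∀ i → DyadicStabilisers (gen i)
dyadicStabilisers Fin.zero = record
  { divisible⇒fixesLevel = a₁-divisible⇒fixesLevel ; fixesLevel⇒divisible = a₁-fixesLevel⇒divisible }
dyadicStabilisers (Fin.suc Fin.zero) = record
  { divisible⇒fixesLevel = a₂-divisible⇒fixesLevel ; fixesLevel⇒divisible = a₂-fixesLevel⇒divisible }
dyadicStabilisers (Fin.suc (Fin.suc Fin.zero)) = record
  { divisible⇒fixesLevel = a₃-divisible⇒fixesLevel ; fixesLevel⇒divisible = a₃-fixesLevel⇒divisible }

bitℕ-injective : ∀ {b c} → bitℕ b ≡ bitℕ c → b ≡ c
bitℕ-injective {false} {false} _ = refl
bitℕ-injective {true}  {true}  _ = refl

bitℕ-full-adder : ∀ x y c → bitℕ ((x xor y) xor c) + 2 * bitℕ (maj x y c) ≡ bitℕ x + bitℕ y + bitℕ c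
bitℕ-full-adder false false false = refl
bitℕ-full-adder false false true  = refl
bitℕ-full-adder false true  false = refl
bitℕ-full-adder false true  true  = refl
bitℕ-full-adder true  false false = refl
bitℕ-full-adder true  false true  = refl
bitℕ-full-adder true  true  false = refl
bitℕ-full-adder true  true  true  = refl

_mod2^_ : ℕ → ℕ → ℕ
j mod2^ n = _%_ j (2 ^ n) {{m^n≢0 2 n}}

mod2^-periodic : ∀ m k n → (m + k * 2 ^ n) mod2^ n ≡ m mod2^ n
mod2^-periodic m k n = [m+kn]%n≡m%n m k (2 ^ n) {{m^n≢0 2 n}}

mod2^-small : ∀ {m} n → m < 2 ^ n → m mod2^ n ≡ m
mod2^-small n = m<n⇒m%n≡m {{m^n≢0 2 n}}

mod2^-decompose : ∀ m n → ∃ λ q → m ≡ m mod2^ n + q * 2 ^ n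
mod2^-decompose m n = _/_ m (2 ^ n) {{m^n≢0 2 n}} , m≡m%n+[m/n]*n m (2 ^ n) {{m^n≢0 2 n}}

truncate : ℕ → ℤ₂ → ℕ
truncate zero    x = 0
truncate (suc m) x = truncate m x + bitℕ (x m) * 2 ^ m

truncate<2^ : ∀ m x → truncate m x < 2 ^ m
truncate<2^ zero    x = s≤s z≤n
truncate<2^ (suc m) x =
  subst (truncate (suc m) x <_) (cong (2 ^ m +_) (sym (+-identityʳ (2 ^ m))))
        (+-mono-<-≤ (truncate<2^ m x) (bit*2^m≤2^m (x m)))
  where
  bit*2^m≤2^m : ∀ b → bitℕ b * 2 ^ m ≤ 2 ^ m
  bit*2^m≤2^m false = z≤n
  bit*2^m≤2^m true  = ≤-reflexive (+-identityʳ (2 ^ m))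

truncate-+ : ∀ i k x → ∃ λ r → truncate (i + k) x ≡ truncate i x + r * 2 ^ i
truncate-+ i zero    x = 0 , trans (cong (λ j → truncate j x) (+-identityʳ i)) (sym (+-identityʳ _))
truncate-+ i (suc k) x with truncate-+ i k x
... | r , e = r + b * 2 ^ k , (begin
  truncate (i + suc k) x                         ≡⟨ cong (λ j → truncate j x) (+-suc i k) ⟩
  truncate (i + k) x + b * 2 ^ (i + k)           ≡⟨ cong₂ (λ t p → t + b * p) e (^-distribˡ-+-* 2 i k) ⟩
  truncate i x + r * 2 ^ i + b * (2 ^ i * 2 ^ k) ≡⟨ regroup (truncate i x) r b (2 ^ i) (2 ^ k) ⟩
  truncate i x + (r + b * 2 ^ k) * 2 ^ i         ∎)
  where
  open ≡-Reasoning
  b = bitℕ (x (i + k))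
  regroup : ∀ t r b p q → t + r * p + b * (p * q) ≡ t + (r + b * q) * p
  regroup = solve-∀

truncate-extend : ∀ {i j} x → i ≤ j → ∃ λ r → truncate j x ≡ truncate i x + r * 2 ^ i
truncate-extend {i} x i≤j with m≤n⇒∃[o]m+o≡n i≤j
... | k , refl = truncate-+ i k x

truncate-mod2^ : ∀ {i j} x → i ≤ j → truncate j x mod2^ i ≡ truncate i x
truncate-mod2^ {i} {j} x i≤j with truncate-extend x i≤j
... | r , e = begin
  truncate j x mod2^ i                ≡⟨ cong (_mod2^ i) e ⟩
  (truncate i x + r * 2 ^ i) mod2^ i ≡⟨ mod2^-periodic (truncate i x) r i ⟩
  truncate i x mod2^ i               ≡⟨ mod2^-small i (truncate<2^ i x) ⟩
  truncate i x                       ∎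
  where open ≡-Reasoning

truncate-cong : ∀ m {x y} → Agree₂ m x y → truncate m x ≡ truncate m y
truncate-cong zero    ag = refl
truncate-cong (suc m) ag = cong₂ (λ t b → t + bitℕ b * 2 ^ m)
  (truncate-cong m (λ i lt → ag i (m<n⇒m<1+n lt))) (ag m ≤-refl)

truncate-suc≡⇒truncate≡ : ∀ m {x y} → truncate (suc m) x ≡ truncate (suc m) y → truncate m x ≡ truncate m y
truncate-suc≡⇒truncate≡ m {x} {y} e =
  trans (sym (truncate-mod2^ x (n≤1+n m))) (trans (cong (_mod2^ m) e) (truncate-mod2^ y (n≤1+n m)))

truncate-injective : ∀ m {x y} → truncate m x ≡ truncate m y → Agree₂ m x y
truncate-injective (suc m) {x} {y} e i (s≤s i≤m) with m≤n⇒m<n∨m≡n i≤m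
... | inj₁ i<m  = truncate-injective m (truncate-suc≡⇒truncate≡ m e) i i<m
... | inj₂ refl = bitℕ-injective (*-cancelʳ-≡ _ _ (2 ^ m) {{m^n≢0 2 m}} (+-cancelˡ-≡ (truncate m x) _ _
    (trans e (cong (_+ bitℕ (y m) * 2 ^ m) (sym (truncate-suc≡⇒truncate≡ m e))))))

truncate-+₂ : ∀ p x y → truncate p x + truncate p y ≡ truncate p (x +₂ y) + bitℕ (carry x y p) * 2 ^ p
truncate-+₂ zero    x y = refl
truncate-+₂ (suc p) x y = begin
  (X + bitℕ (x p) * P) + (Y + bitℕ (y p) * P)           ≡⟨ regroup₁ X Y P (bitℕ (x p)) (bitℕ (y p)) ⟩
  (X + Y) + (bitℕ (x p) + bitℕ (y p)) * P               ≡⟨ cong (_+ (bitℕ (x p) + bitℕ (y p)) * P) (truncate-+₂ p x y) ⟩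
  (S + c * P) + (bitℕ (x p) + bitℕ (y p)) * P           ≡⟨ regroup₂ S P (bitℕ (x p)) (bitℕ (y p)) c ⟩
  S + (bitℕ (x p) + bitℕ (y p) + c) * P                 ≡⟨ cong (λ t → S + t * P) (sym (bitℕ-full-adder (x p) (y p) (carry x y p))) ⟩
  S + (bitℕ ((x +₂ y) p) + 2 * c′) * P                  ≡⟨ regroup₃ S P (bitℕ ((x +₂ y) p)) c′ ⟩
  (S + bitℕ ((x +₂ y) p) * P) + c′ * (2 * P)            ∎
  where
  open ≡-Reasoning
  X = truncate p x
  Y = truncate p y
  S = truncate p (x +₂ y)
  P = 2 ^ p
  c = bitℕ (carry x y p)
  c′ = bitℕ (carry x y (suc p))
  regroup₁ : ∀ X Y P b b′ → (X + b * P) + (Y + b′ * P) ≡ (X + Y) + (b + b′) * P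
  regroup₁ = solve-∀
  regroup₂ : ∀ S P b b′ c → (S + c * P) + (b + b′) * P ≡ S + (b + b′ + c) * P
  regroup₂ = solve-∀
  regroup₃ : ∀ S P s c′ → S + (s + 2 * c′) * P ≡ (S + s * P) + c′ * (2 * P)
  regroup₃ = solve-∀

digits : ℕ → ℤ₂
digits j zero    = lowBit j
digits j (suc i) = digits ⌊ j /2⌋ i

truncate-suc-low : ∀ p x → truncate (suc p) x ≡ bitℕ (x 0) + truncate p (λ i → x (suc i)) * 2
truncate-suc-low zero    x = trans (*-identityʳ _) (sym (+-identityʳ _))
truncate-suc-low (suc p) x = begin
  truncate (suc p) x + b * 2 ^ suc p                      ≡⟨ cong (_+ b * 2 ^ suc p) (truncate-suc-low p x) ⟩
  bitℕ (x 0) + truncate p x′ * 2 + b * (2 * 2 ^ p)        ≡⟨ regroup (bitℕ (x 0)) (truncate p x′) b (2 ^ p) ⟩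
  bitℕ (x 0) + (truncate p x′ + b * 2 ^ p) * 2            ∎
  where
  open ≡-Reasoning
  x′ = λ i → x (suc i)
  b = bitℕ (x (suc p))
  regroup : ∀ b₀ t b P → b₀ + t * 2 + b * (2 * P) ≡ b₀ + (t + b * P) * 2
  regroup = solve-∀

digits-split : ∀ p j → ∃ λ q → j ≡ truncate p (digits j) + q * 2 ^ p
digits-split zero    j = j , sym (*-identityʳ j)
digits-split (suc p) j with digits-split p ⌊ j /2⌋
... | q , e = q , (begin
  j                                                     ≡⟨ n≡lowBit+⌊n/2⌋*2 j ⟩
  bitℕ (lowBit j) + ⌊ j /2⌋ * 2                         ≡⟨ cong (λ h → bitℕ (lowBit j) + h * 2) e ⟩
  bitℕ (lowBit j) + (T + q * 2 ^ p) * 2                 ≡⟨ regroup (bitℕ (lowBit j)) T q (2 ^ p) ⟩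
  (bitℕ (lowBit j) + T * 2) + q * (2 * 2 ^ p)           ≡⟨ cong (_+ q * 2 ^ suc p) (sym (truncate-suc-low p (digits j))) ⟩
  truncate (suc p) (digits j) + q * 2 ^ suc p           ∎)
  where
  open ≡-Reasoning
  T = truncate p (digits ⌊ j /2⌋)
  regroup : ∀ b T q P → b + (T + q * P) * 2 ≡ (b + T * 2) + q * (2 * P)
  regroup = solve-∀

truncate-digits : ∀ p j → truncate p (digits j) ≡ j mod2^ p
truncate-digits p j with digits-split p j
... | q , e = sym (begin
  j mod2^ p                                 ≡⟨ cong (_mod2^ p) e ⟩
  (truncate p (digits j) + q * 2 ^ p) mod2^ p ≡⟨ mod2^-periodic (truncate p (digits j)) q p ⟩
  truncate p (digits j) mod2^ p             ≡⟨ mod2^-small p (truncate<2^ p (digits j)) ⟩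
  truncate p (digits j)                     ∎)
  where open ≡-Reasoning

module ClosureIsoℤ₂ {a : Aut} (S : DyadicStabilisers a) where
  open DyadicStabilisers S

  pow-agree-mod2^ : ∀ n j → AgreeA n (powℕ a j) (powℕ a (j mod2^ n))
  pow-agree-mod2^ n j with mod2^-decompose j n
  ... | q , e = subst (λ i → AgreeA n (powℕ a i) (powℕ a (j mod2^ n))) (sym e)
    (pow-periodic n a (j mod2^ n) (q * 2 ^ n) (divisible⇒fixesLevel n (divides q refl)))

  pow-agree⇒mod2^≡-≤ : ∀ m {j k} → j ≤ k → AgreeA (m * 3) (powℕ a j) (powℕ a k) → k mod2^ m ≡ j mod2^ m
  pow-agree⇒mod2^≡-≤ m {j} j≤k ag with m≤n⇒∃[o]m+o≡n j≤k
  ... | d , refl with fixesLevel⇒divisible m {d} (pow-agree⇒fixesLevel (m * 3) a j d ag)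
  ... | divides q refl = mod2^-periodic j q m

  pow-agree⇒mod2^≡ : ∀ m j k → AgreeA (m * 3) (powℕ a j) (powℕ a k) → j mod2^ m ≡ k mod2^ m
  pow-agree⇒mod2^≡ m j k ag with ≤-total j k
  ... | inj₁ j≤k = sym (pow-agree⇒mod2^≡-≤ m j≤k ag)
  ... | inj₂ k≤j = pow-agree⇒mod2^≡-≤ m k≤j (agree-sym ag)

  closure-approx : ∀ {g} → InClosure a g → ∀ n → ∃ λ j → AgreeA n g (powℕ a j)
  closure-approx cl n with cl n
  ... | ℤ.+ j , ag = j , ag
  ... | ℤ.-[1+ t ] , ag with m≤n⇒∃[o]m+o≡n (m≤m*n (suc t) (2 ^ n) {{m^n≢0 2 n}})
  ... | o , s+o≡s*2^n = o , agree-trans ag (invA-pow-agree n a (suc t) o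
        (divisible⇒fixesLevel n (divides (suc t) (trans (+-comm o (suc t)) s+o≡s*2^n))))

  -- φ x = lim a^(x mod 2ⁿ): the label at v is already stable at n = length v + 1.
  φ : ℤ₂ → Aut
  φ x v = powℕ a (truncate (suc (length v)) x) v

  φ-approx : ∀ x {n m} → n ≤ m → AgreeA n (φ x) (powℕ a (truncate m x))
  φ-approx x n≤m v lt with truncate-extend x (≤-trans lt n≤m)
  ... | r , e = sym (trans (cong (λ t → powℕ a t v) e)
    (pow-periodic p a (truncate p x) (r * 2 ^ p) (divisible⇒fixesLevel p (divides r refl)) v ≤-refl))
    where p = suc (length v)

  φ-agree₂⇒agree : ∀ n x y → Agree₂ n x y → AgreeA n (φ x) (φ y)
  φ-agree₂⇒agree n x y ag = begin
    φ x                         ≈⟨ φ-approx x ≤-refl ⟩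
    powℕ a (truncate n x)       ≡⟨ cong (powℕ a) (truncate-cong n ag) ⟩
    powℕ a (truncate n y)       ≈⟨ agree-sym (φ-approx y ≤-refl) ⟩
    φ y                         ∎
    where open AgreeReasoning n

  φ-agree⇒agree₂ : ∀ m x y → AgreeA (m * 3) (φ x) (φ y) → Agree₂ m x y
  φ-agree⇒agree₂ m x y ag = truncate-injective m (begin
    truncate m x               ≡⟨ sym (truncate-mod2^ x m≤m*3) ⟩
    truncate (m * 3) x mod2^ m ≡⟨ pow-agree⇒mod2^≡ m _ _ powers-agree ⟩
    truncate (m * 3) y mod2^ m ≡⟨ truncate-mod2^ y m≤m*3 ⟩
    truncate m y               ∎)
    where
    open ≡-Reasoning
    m≤m*3 : m ≤ m * 3
    m≤m*3 = m≤m*n m 3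
    powers-agree : AgreeA (m * 3) (powℕ a (truncate (m * 3) x)) (powℕ a (truncate (m * 3) y))
    powers-agree = agree-trans (agree-sym (φ-approx x ≤-refl)) (agree-trans ag (φ-approx y ≤-refl))

  φ-homomorphic : ∀ x y → φ (x +₂ y) ≈A (φ x ∘A φ y)
  φ-homomorphic x y v = begin
    powℕ a (truncate p (x +₂ y)) v                             ≡⟨ pow-periodic p a (truncate p (x +₂ y)) _ carry-fixes v ≤-refl ⟨
    powℕ a (truncate p (x +₂ y) + bitℕ (carry x y p) * 2 ^ p) v ≡⟨ cong (λ t → powℕ a t v) (truncate-+₂ p x y) ⟨
    powℕ a (truncate p x + truncate p y) v                     ≡⟨ pow-+ a (truncate p x) (truncate p y) v ⟩
    (powℕ a (truncate p x) ∘A powℕ a (truncate p y)) v         ≡⟨ ∘-cong-agree p (φ-approx x ≤-refl) (φ-approx y ≤-refl) v ≤-refl ⟨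
    (φ x ∘A φ y) v                                             ∎
    where
    open ≡-Reasoning
    p = suc (length v)
    carry-fixes : FixesLevel p (powℕ a (bitℕ (carry x y p) * 2 ^ p))
    carry-fixes = divisible⇒fixesLevel p (divides (bitℕ (carry x y p)) refl)

  φ-onto : ∀ g → InClosure a g → ∃ λ x → φ x ≈A g
  φ-onto g cl = x , φx≈g
    where
    j : ℕ → ℕ
    j n = proj₁ (closure-approx cl n)
    g≈aʲ : ∀ n → AgreeA n g (powℕ a (j n))
    g≈aʲ n = proj₂ (closure-approx cl n)
    -- Approximating g at level 3(i + 1) pins down the exponent modulo 2^(i + 1).
    x : ℤ₂
    x i = digits (j (suc i * 3)) i
    x-digit : ∀ p i → i < p → x i ≡ digits (j (p * 3)) i
    x-digit p i i<p = truncate-injective (suc i) (begin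
      truncate (suc i) (digits j₁) ≡⟨ truncate-digits (suc i) j₁ ⟩
      j₁ mod2^ suc i               ≡⟨ pow-agree⇒mod2^≡ (suc i) j₁ j₂ powers-agree ⟩
      j₂ mod2^ suc i               ≡⟨ truncate-digits (suc i) j₂ ⟨
      truncate (suc i) (digits j₂) ∎) i ≤-refl
      where
      open ≡-Reasoning
      j₁ = j (suc i * 3)
      j₂ = j (p * 3)
      powers-agree : AgreeA (suc i * 3) (powℕ a j₁) (powℕ a j₂)
      powers-agree = agree-trans (agree-sym (g≈aʲ (suc i * 3))) (agree-mono (*-monoˡ-≤ 3 i<p) (g≈aʲ (p * 3)))
    φx≈g : φ x ≈A g
    φx≈g v = begin
      powℕ a (truncate p x) v             ≡⟨ cong (λ t → powℕ a t v) (truncate-cong p (x-digit p)) ⟩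
      powℕ a (truncate p (digits j₂)) v   ≡⟨ cong (λ t → powℕ a t v) (truncate-digits p j₂) ⟩
      powℕ a (j₂ mod2^ p) v               ≡⟨ pow-agree-mod2^ p j₂ v ≤-refl ⟨
      powℕ a j₂ v                         ≡⟨ g≈aʲ (p * 3) v (m≤m*n p 3) ⟨
      g v                                 ∎
      where
      open ≡-Reasoning
      p = suc (length v)
      j₂ = j (p * 3)

  closure≅ℤ₂ : ClosedSubgroupIsoℤ₂ a
  closure≅ℤ₂ = φ , record
    { into         = λ x n → ℤ.+ truncate n x , φ-approx x ≤-refl
    ; onto         = φ-onto
    ; injective    = λ x y φx≈φy i → φ-agree⇒agree₂ (suc i) x y (≈⇒agree _ φx≈φy) i ≤-refl
    ; homomorph    = φ-homomorphic
    ; continuous   = λ n → n , φ-agree₂⇒agree n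
    ; continuous⁻¹ = λ m → m * 3 , φ-agree⇒agree₂ m
    }

corollary7p7 : (i : Fin 3) → ClosedSubgroupIsoℤ₂ (gen i)
corollary7p7 i = ClosureIsoℤ₂.closure≅ℤ₂ (dyadicStabilisers i)
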